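{- Let $d\ge 2$ and let $H$ be a connected $d$-uniform hypergraph with $s\ge 1$ hyperedges and $r$ vertices (each hyperedge is a set of $d$ distinct vertices). If $H$ is a hypertree, then some hyperedge of $H$ contains at least $d-1$ isolated vertices. If $H$ is unicyclic, then either some hyperedge contains at least $d-1$ isolated vertices, or some hyperedge contains $d-2$ isolated vertices and removing that hyperedge (together with its isolated vertices) turns $H$ into a hypertree.
   Context: A connected $d$-uniform hypergraph with $r$ vertices and $s$ hyperedges is a hypertree if $r=s(d-1)+1$ and unicyclic if $r=s(d-1)$. A vertex is isolated (with respect to a hyperedge containing it) if it belongs to exactly one hyperedge. -}

module Defs where

open import Data.Nat using (ℕ; suc; _+_; _*_; _∸_; _≡ᵇ_)
open import Data.Bool using (Bool; true; false; _∧_)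
open import Data.Fin using (Fin)
open import Data.Fin.Subset using (Subset; _∈_; _⊆_; ∣_∣)
open import Data.Vec using (lookup; tabulate)
open import Data.Product using (Σ; ∃; _×_)
open import Function.Definitions using (Injective)
open import Relation.Binary.PropositionalEquality using (_≡_)
open import Relation.Binary.Construct.Closure.ReflexiveTransitive using (Star)

-- A hypergraph: vertices form a subset V of an ambient Fin n, and it has
-- s hyperedges E i (i : Fin s), each a subset of Fin n.

IsUniformHypergraph : ∀ {n s} → ℕ → Subset n → (Fin s → Subset n) → Set
IsUniformHypergraph d V E =
  ((i : _) → ∣ E i ∣ ≡ d × E i ⊆ V) × Injective _≡_ _≡_ E

Adjacent : ∀ {n s} → (Fin s → Subset n) → Fin n → Fin n → Set
Adjacent E u v = ∃ λ i → u ∈ E i × v ∈ E i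

Connected : ∀ {n s} → Subset n → (Fin s → Subset n) → Set
Connected V E = ∀ u v → u ∈ V → v ∈ V → Star (Adjacent E) u v

edgesAt : ∀ {n s} → (Fin s → Subset n) → Fin n → Subset s
edgesAt E v = tabulate λ i → lookup (E i) v

degree : ∀ {n s} → (Fin s → Subset n) → Fin n → ℕ
degree E v = ∣ edgesAt E v ∣

isolatedIn : ∀ {n s} → (Fin s → Subset n) → Fin s → Subset n
isolatedIn E i = tabulate λ v → lookup (E i) v ∧ (degree E v ≡ᵇ 1)

IsHypertree : ∀ {n s} → ℕ → Subset n → (Fin s → Subset n) → Set
IsHypertree {s = s} d V E =
  IsUniformHypergraph d V E × Connected V E × ∣ V ∣ ≡ s * (d ∸ 1) + 1

IsUnicyclic : ∀ {n s} → ℕ → Subset n → (Fin s → Subset n) → Set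
IsUnicyclic {s = s} d V E =
  IsUniformHypergraph d V E × Connected V E × ∣ V ∣ ≡ s * (d ∸ 1)

module Submission where

-- Call the vertices of a hyperedge that lie in some further hyperedge its
-- core; the other vertices are its isolated ones, so a hyperedge has
-- (#isolated) + (#core) = d vertices.  Double counting incidences gives
--   Σᵢ ∣core i∣ + 2r ≤ 2sd,                                         (★)
-- because a vertex of degree k contributes k (if k ≥ 2) or 0 (if k = 1) to
-- the core sizes, plus 2 as a vertex, against 2k on the right.  If no
-- hyperedge has d-1 isolated vertices (no leaf), every core has at least 2
-- vertices, so Σᵢ ∣core i∣ ≥ 2s.  For a hypertree, r = s(d-1)+1 contradicts
-- (★).  For a unicyclic hypergraph, r = s(d-1) forces equality throughout:
-- every hyperedge has exactly 2 core vertices and d-2 isolated ones, and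
-- every core vertex has degree 2.  The core is then one cycle; following it
-- (a rotation generated by two fixed-point-free involutions on flags, which
-- returns to its start but never reverses) joins the two core vertices of a
-- hyperedge without using it.  So deleting that hyperedge with its isolated
-- vertices leaves a connected d-uniform hypergraph with s-1 hyperedges and
-- s(d-1)-(d-2) = (s-1)(d-1)+1 vertices, a hypertree.

open import Defs
open import Data.Nat using (ℕ; zero; suc; _+_; _*_; _∸_; _≤_; z≤n; s≤s; _≡ᵇ_; _≤?_)
open import Data.Nat.Properties
open import Data.Nat.Tactic.RingSolver using (solve-∀)
open import Data.Bool using (Bool; true; false; _∧_; not; T)
open import Data.Bool.Properties using (∧-identityʳ; ∧-zeroʳ; ∧-conicalˡ; ∧-conicalʳ; not-involutive)
open import Data.Fin using (Fin; zero; suc; toℕ; punchIn; punchOut; combine)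
open import Data.Fin.Properties
  using (any?; pigeonhole; combine-injective; punchIn-punchOut; punchIn-injective; punchInᵢ≢i)
  renaming (_≟_ to _≟ᶠ_)
open import Data.Fin.Subset using (Subset; outside; ∣_∣; _∈_; _∉_; _⊆_; _─_; _-_; ⁅_⁆; Nonempty)
open import Data.Fin.Subset.Properties
  using (x∈p⇒∣p-x∣<∣p∣; x∈p∧x≢y⇒x∈p-y; x∈p∧x∉q⇒x∈p─q; p─q⊆p; x∉⁅y⁆⇒x≢y; x∈⁅x⁆; ∣⁅x⁆∣≡1;
         p⊆q⇒∣p∣≤∣q∣; nonempty?; Empty-unique; ∣⊥∣≡0; _∈?_; drop-∷-⊆)
open import Data.Vec using ([]; _∷_; here; there; lookup; tabulate)
open import Data.Vec.Properties using (lookup∘tabulate; tabulate∘lookup; tabulate-cong; []=⇒lookup; lookup⇒[]=)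
open import Data.Product using (∃; _×_; _,_; proj₁; proj₂)
open import Data.Sum using (_⊎_; inj₁; inj₂; [_,_]′)
open import Data.Empty using (⊥-elim)
open import Function using (_∘_; id)
open import Function.Definitions using (Injective)
open import Relation.Binary.PropositionalEquality
open import Relation.Nullary using (¬_; Dec; yes; no; contradiction)
open import Relation.Nullary.Decidable using (dec-true; dec-false)
open import Relation.Binary.Construct.Closure.ReflexiveTransitive
  using (Star; ε; _◅_; _◅◅_; reverse; kleisliStar)
open import Algebra.Properties.CommutativeMonoid.Sum +-0-commutativeMonoid
  using (sum; sum-cong-≗; ∑-distrib-+; ∑-comm)

sum-mono : ∀ {m} {f g : Fin m → ℕ} → (∀ i → f i ≤ g i) → sum f ≤ sum g
sum-mono {zero}  f≤g = z≤n
sum-mono {suc m} f≤g = +-mono-≤ (f≤g zero) (sum-mono (f≤g ∘ suc))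

sum-const : ∀ m c → sum {m} (λ _ → c) ≡ m * c
sum-const zero    c = refl
sum-const (suc m) c = cong (c +_) (sum-const m c)

sum-tight : ∀ {m} {f g : Fin m → ℕ} →
            (∀ i → f i ≤ g i) → sum g ≤ sum f → ∀ i → f i ≡ g i
sum-tight {suc m} {f} {g} f≤g g≤f zero = ≤-antisym (f≤g zero)
  (+-cancelʳ-≤ (sum (g ∘ suc)) _ _
    (≤-trans g≤f (+-monoʳ-≤ (f zero) (sum-mono (f≤g ∘ suc)))))
sum-tight {suc m} {f} {g} f≤g g≤f (suc i) = sum-tight (f≤g ∘ suc)
  (+-cancelˡ-≤ (g zero) _ _ (≤-trans g≤f (+-monoˡ-≤ (sum (f ∘ suc)) (f≤g zero)))) i

𝟙 : Bool → ℕ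
𝟙 true  = 1
𝟙 false = 0

∣∣≡sum : ∀ {m} (p : Subset m) → ∣ p ∣ ≡ sum (𝟙 ∘ lookup p)
∣∣≡sum []          = refl
∣∣≡sum (true  ∷ p) = cong suc (∣∣≡sum p)
∣∣≡sum (false ∷ p) = ∣∣≡sum p

∣tabulate∣≡sum : ∀ {m} (f : Fin m → Bool) → ∣ tabulate f ∣ ≡ sum (𝟙 ∘ f)
∣tabulate∣≡sum f = trans (∣∣≡sum (tabulate f)) (sum-cong-≗ (cong 𝟙 ∘ lookup∘tabulate f))

split-count : ∀ {m} (p : Subset m) (c : Fin m → Bool) →
              ∣ tabulate (λ x → lookup p x ∧ c x) ∣ + ∣ tabulate (λ x → lookup p x ∧ not (c x)) ∣ ≡ ∣ p ∣
split-count p c = begin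
  ∣ tabulate (λ x → lookup p x ∧ c x) ∣ + ∣ tabulate (λ x → lookup p x ∧ not (c x)) ∣
    ≡⟨ cong₂ _+_ (∣tabulate∣≡sum (λ x → lookup p x ∧ c x)) (∣tabulate∣≡sum (λ x → lookup p x ∧ not (c x))) ⟩
  sum (λ x → 𝟙 (lookup p x ∧ c x)) + sum (λ x → 𝟙 (lookup p x ∧ not (c x)))
    ≡⟨ ∑-distrib-+ (λ x → 𝟙 (lookup p x ∧ c x)) (λ x → 𝟙 (lookup p x ∧ not (c x))) ⟨
  sum (λ x → 𝟙 (lookup p x ∧ c x) + 𝟙 (lookup p x ∧ not (c x)))
    ≡⟨ sum-cong-≗ (λ x → 𝟙-split (lookup p x) (c x)) ⟩
  sum (𝟙 ∘ lookup p)
    ≡⟨ ∣∣≡sum p ⟨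
  ∣ p ∣ ∎
  where
  open ≡-Reasoning
  𝟙-split : ∀ b c → 𝟙 (b ∧ c) + 𝟙 (b ∧ not c) ≡ 𝟙 b
  𝟙-split true  true  = refl
  𝟙-split true  false = refl
  𝟙-split false c     = refl

double-count : ∀ {s m} (R : Fin s → Fin m → Bool) →
               sum (λ i → ∣ tabulate (R i) ∣) ≡ sum (λ x → ∣ tabulate (λ i → R i x) ∣)
double-count R = begin
  sum (λ i → ∣ tabulate (R i) ∣)           ≡⟨ sum-cong-≗ (λ i → ∣tabulate∣≡sum (R i)) ⟩
  sum (λ i → sum (λ x → 𝟙 (R i x)))       ≡⟨ ∑-comm (λ i x → 𝟙 (R i x)) ⟩
  sum (λ x → sum (λ i → 𝟙 (R i x)))       ≡⟨ sum-cong-≗ (λ x → ∣tabulate∣≡sum (λ i → R i x)) ⟨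
  sum (λ x → ∣ tabulate (λ i → R i x) ∣)  ∎
  where open ≡-Reasoning

count-∧-const : ∀ {m} (f : Fin m → Bool) c → ∣ tabulate (λ i → f i ∧ c) ∣ ≡ 𝟙 c * ∣ tabulate f ∣
count-∧-const f true  = trans (cong ∣_∣ (tabulate-cong (∧-identityʳ ∘ f))) (sym (*-identityˡ _))
count-∧-const {m} f false = begin
  ∣ tabulate (λ i → f i ∧ false) ∣  ≡⟨ ∣tabulate∣≡sum (λ i → f i ∧ false) ⟩
  sum (λ i → 𝟙 (f i ∧ false))      ≡⟨ sum-cong-≗ (cong 𝟙 ∘ ∧-zeroʳ ∘ f) ⟩
  sum {m} (λ _ → 0)                ≡⟨ trans (sum-const m 0) (*-zeroʳ m) ⟩
  0                                ∎
  where open ≡-Reasoning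

∈-tabulate⁻ : ∀ {m} {f : Fin m → Bool} {x} → x ∈ tabulate f → f x ≡ true
∈-tabulate⁻ {f = f} {x} x∈ = trans (sym (lookup∘tabulate f x)) ([]=⇒lookup x∈)

∈-tabulate⁺ : ∀ {m} {f : Fin m → Bool} {x} → f x ≡ true → x ∈ tabulate f
∈-tabulate⁺ {f = f} {x} fx = lookup⇒[]= x (tabulate f) (trans (lookup∘tabulate f x) fx)

∈─⇒∉ : ∀ {m} (p q : Subset m) {x} → x ∈ p ─ q → x ∉ q
∈─⇒∉ (_ ∷ p) (outside ∷ q) here         ()
∈─⇒∉ (_ ∷ p) (_       ∷ q) (there x∈p─q) (there x∈q) = ∈─⇒∉ p q x∈p─q x∈q

∈-remove⁻ : ∀ {m} {p : Subset m} {x y} → y ∈ p - x → y ∈ p × y ≢ x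
∈-remove⁻ {p = p} {x} y∈ = p─q⊆p p ⁅ x ⁆ y∈ , x∉⁅y⁆⇒x≢y (∈─⇒∉ p ⁅ x ⁆ y∈)

one-member : ∀ {m} {p : Subset m} {x} → x ∈ p → 1 ≤ ∣ p ∣
one-member x∈p = ≤-trans (s≤s z≤n) (x∈p⇒∣p-x∣<∣p∣ x∈p)

two-members : ∀ {m} {p : Subset m} {x y} → x ∈ p → y ∈ p → x ≢ y → 2 ≤ ∣ p ∣
two-members x∈p y∈p x≢y =
  ≤-trans (s≤s (one-member (x∈p∧x≢y⇒x∈p-y y∈p (x≢y ∘ sym)))) (x∈p⇒∣p-x∣<∣p∣ x∈p)

three-members : ∀ {m} {p : Subset m} {x y z} → x ∈ p → y ∈ p → z ∈ p →
                x ≢ y → x ≢ z → y ≢ z → 3 ≤ ∣ p ∣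
three-members x∈p y∈p z∈p x≢y x≢z y≢z = ≤-trans
  (s≤s (two-members (x∈p∧x≢y⇒x∈p-y y∈p (x≢y ∘ sym)) (x∈p∧x≢y⇒x∈p-y z∈p (x≢z ∘ sym)) y≢z))
  (x∈p⇒∣p-x∣<∣p∣ x∈p)

nonempty : ∀ {m} {p : Subset m} → 1 ≤ ∣ p ∣ → Nonempty p
nonempty {m} {p} 1≤∣p∣ with nonempty? p
... | yes ne = ne
... | no  empty = contradiction (trans (cong ∣_∣ (Empty-unique empty)) (∣⊥∣≡0 m)) (m≢0 1≤∣p∣)
  where
  m≢0 : ∀ {k} → 1 ≤ k → k ≢ 0
  m≢0 (s≤s _) ()

partner : ∀ {m} → Subset m → Fin m → Fin m
partner p x with nonempty? (p - x)
... | yes (y , _) = y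
... | no  _       = x

module Pair {m} {p : Subset m} (∣p∣≡2 : ∣ p ∣ ≡ 2) where

  partner-spec : ∀ {x} → x ∈ p → partner p x ∈ p × partner p x ≢ x
  partner-spec {x} x∈p with nonempty? (p - x)
  ... | yes (y , y∈p-x) = ∈-remove⁻ y∈p-x
  ... | no  empty = ⊥-elim (2≰1 (subst (_≤ 1) ∣p∣≡2 ∣p∣≤1))
    where
    2≰1 : ¬ (2 ≤ 1)
    2≰1 (s≤s ())
    only-x : ∀ {y} → y ∈ p → y ∈ ⁅ x ⁆
    only-x {y} y∈p with y ≟ᶠ x
    ... | yes refl = x∈⁅x⁆ x
    ... | no  y≢x  = ⊥-elim (empty (y , x∈p∧x≢y⇒x∈p-y y∈p y≢x))
    ∣p∣≤1 : ∣ p ∣ ≤ 1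
    ∣p∣≤1 = subst (∣ p ∣ ≤_) (∣⁅x⁆∣≡1 x) (p⊆q⇒∣p∣≤∣q∣ only-x)

  partner-∈ : ∀ {x} → x ∈ p → partner p x ∈ p
  partner-∈ = proj₁ ∘ partner-spec

  partner-≢ : ∀ {x} → x ∈ p → partner p x ≢ x
  partner-≢ = proj₂ ∘ partner-spec

  partner-cases : ∀ {x z} → x ∈ p → z ∈ p → z ≡ x ⊎ z ≡ partner p x
  partner-cases {x} {z} x∈p z∈p with z ≟ᶠ x | z ≟ᶠ partner p x
  ... | yes z≡x | _       = inj₁ z≡x
  ... | no  _   | yes z≡y = inj₂ z≡y
  ... | no  z≢x | no  z≢y = ⊥-elim (3≰2 (subst (3 ≤_) ∣p∣≡2
          (three-members x∈p (partner-∈ x∈p) z∈p (partner-≢ x∈p ∘ sym) (z≢x ∘ sym) (z≢y ∘ sym))))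
    where
    3≰2 : ¬ (3 ≤ 2)
    3≰2 (s≤s (s≤s ()))

  partner-involutive : ∀ {x} → x ∈ p → partner p (partner p x) ≡ x
  partner-involutive {x} x∈p with partner-cases (partner-∈ x∈p) x∈p
  ... | inj₁ x≡y = ⊥-elim (partner-≢ x∈p (sym x≡y))
  ... | inj₂ x≡z = sym x≡z

∣p─q∣+∣q∣ : ∀ {m} (p q : Subset m) → q ⊆ p → ∣ p ─ q ∣ + ∣ q ∣ ≡ ∣ p ∣
∣p─q∣+∣q∣ []          []          _   = refl
∣p─q∣+∣q∣ (true  ∷ p) (false ∷ q) q⊆p = cong suc (∣p─q∣+∣q∣ p q (drop-∷-⊆ q⊆p))
∣p─q∣+∣q∣ (false ∷ p) (false ∷ q) q⊆p = ∣p─q∣+∣q∣ p q (drop-∷-⊆ q⊆p)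
∣p─q∣+∣q∣ (true  ∷ p) (true  ∷ q) q⊆p = trans (+-suc _ _) (cong suc (∣p─q∣+∣q∣ p q (drop-∷-⊆ q⊆p)))
∣p─q∣+∣q∣ (false ∷ p) (true  ∷ q) q⊆p with () ← q⊆p here

module Reflections {A : Set} (P : A → Set) (g h : A → A)
  (g-closed : ∀ {x} → P x → P (g x)) (h-closed : ∀ {x} → P x → P (h x))
  (g-involutive : ∀ {x} → P x → g (g x) ≡ x) (h-involutive : ∀ {x} → P x → h (h x) ≡ x)
  (g-fixpoint-free : ∀ {x} → P x → g x ≢ x) (h-fixpoint-free : ∀ {x} → P x → h x ≢ x)
  where

  rotate : A → A
  rotate x = h (g x)

  rotate-closed : ∀ {x} → P x → P (rotate x)
  rotate-closed Px = h-closed (g-closed Px)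

  rotate-injective : ∀ {x y} → P x → P y → rotate x ≡ rotate y → x ≡ y
  rotate-injective {x} {y} Px Py eq = begin
    x                 ≡⟨ g-involutive Px ⟨
    g (g x)           ≡⟨ cong g (h-involutive (g-closed Px)) ⟨
    g (h (rotate x))  ≡⟨ cong (g ∘ h) eq ⟩
    g (h (rotate y))  ≡⟨ cong g (h-involutive (g-closed Py)) ⟩
    g (g y)           ≡⟨ g-involutive Py ⟩
    y                 ∎
    where open ≡-Reasoning

  rotate-g-rotate : ∀ {x} → P x → rotate (g (rotate x)) ≡ g x
  rotate-g-rotate {x} Px = begin
    h (g (g (h (g x))))  ≡⟨ cong h (g-involutive (h-closed (g-closed Px))) ⟩
    h (h (g x))          ≡⟨ h-involutive (g-closed Px) ⟩
    g x                  ∎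
    where open ≡-Reasoning

  rotate^ : ℕ → A → A
  rotate^ zero    x = x
  rotate^ (suc k) x = rotate (rotate^ k x)

  rotate^-closed : ∀ k {x} → P x → P (rotate^ k x)
  rotate^-closed zero    Px = Px
  rotate^-closed (suc k) Px = rotate-closed (rotate^-closed k Px)

  rotate^-injective : ∀ k {x y} → P x → P y → rotate^ k x ≡ rotate^ k y → x ≡ y
  rotate^-injective zero    Px Py eq = eq
  rotate^-injective (suc k) Px Py eq = rotate^-injective k Px Py
    (rotate-injective (rotate^-closed k Px) (rotate^-closed k Py) eq)

  rotate^-suc : ∀ k x → rotate^ k (rotate x) ≡ rotate^ (suc k) x
  rotate^-suc zero    x = refl
  rotate^-suc (suc k) x = cong rotate (rotate^-suc k x)

  rotate^-+ : ∀ i j x → rotate^ (i + j) x ≡ rotate^ i (rotate^ j x)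
  rotate^-+ zero    j x = refl
  rotate^-+ (suc i) j x = cong rotate (rotate^-+ i j x)

  -- No orbit of the rotation passes through the g-reflection of its
  -- starting point: the cases m = 0, 1 are the fixed-point-freeness of
  -- g and h, and rotate-g-rotate reduces m + 2 to m.
  never-reflects : ∀ m {x} → P x → rotate^ m x ≢ g x
  never-reflects zero          Px eq = g-fixpoint-free Px (sym eq)
  never-reflects (suc zero)    Px eq = h-fixpoint-free (g-closed Px) eq
  never-reflects (suc (suc m)) {x} Px eq =
    never-reflects m (rotate-closed Px)
      (rotate-injective (rotate^-closed m (rotate-closed Px)) (g-closed (rotate-closed Px))
        (begin
          rotate (rotate^ m (rotate x))  ≡⟨ cong rotate (rotate^-suc m x) ⟩
          rotate^ (suc (suc m)) x        ≡⟨ eq ⟩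
          g x                            ≡⟨ rotate-g-rotate Px ⟨
          rotate (g (rotate x))          ∎))
    where open ≡-Reasoning

  -- If the points are coded injectively into a finite set, every orbit
  -- returns to its starting point (pigeonhole plus injectivity of rotate).
  returns : ∀ {N} (code : A → Fin N) → Injective _≡_ _≡_ code →
            ∀ {x} → P x → ∃ λ t → rotate^ (suc t) x ≡ x
  returns {N} code code-injective {x} Px
    with i , j , i<j , same ← pigeonhole (n<1+n N) (λ i → code (rotate^ (toℕ i) x))
    with t , i+1+t≡j ← m≤n⇒∃[o]m+o≡n i<j
    = t , rotate^-injective (toℕ i) (rotate^-closed (suc t) Px) Px (begin
        rotate^ (toℕ i) (rotate^ (suc t) x)  ≡⟨ rotate^-+ (toℕ i) (suc t) x ⟨
        rotate^ (toℕ i + suc t) x            ≡⟨ cong (λ k → rotate^ k x) (trans (+-suc (toℕ i) t) i+1+t≡j) ⟩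
        rotate^ (toℕ j) x                    ≡⟨ code-injective same ⟨
        rotate^ (toℕ i) x                    ∎)
    where open ≡-Reasoning

≡ᵇ⁻ : ∀ {m n} → (m ≡ᵇ n) ≡ true → m ≡ n
≡ᵇ⁻ {m} {n} e = ≡ᵇ⇒≡ m n (subst T (sym e) _)

≢ᵇ⁻ : ∀ {m n} → not (m ≡ᵇ n) ≡ true → m ≢ n
≢ᵇ⁻ {m} {n} e m≡n = subst T (trans (sym (not-involutive _)) (cong not e)) (≡⇒≡ᵇ m n m≡n)

∈-restrict⁻ : ∀ {m} {p : Subset m} {c : Fin m → Bool} {x} →
              x ∈ tabulate (λ v → lookup p v ∧ c v) → x ∈ p × c x ≡ true
∈-restrict⁻ {p = p} {x = x} x∈ =
  lookup⇒[]= x p (∧-conicalˡ _ _ (∈-tabulate⁻ x∈)) , ∧-conicalʳ _ _ (∈-tabulate⁻ x∈)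

∈-restrict⁺ : ∀ {m} {p : Subset m} {c : Fin m → Bool} {x} →
              x ∈ p → c x ≡ true → x ∈ tabulate (λ v → lookup p v ∧ c v)
∈-restrict⁺ x∈p cx = ∈-tabulate⁺ (cong₂ _∧_ ([]=⇒lookup x∈p) cx)

core : ∀ {n s} → (Fin s → Subset n) → Fin s → Subset n
core E i = tabulate λ v → lookup (E i) v ∧ not (degree E v ≡ᵇ 1)

module _ {n s} {E : Fin s → Subset n} where

  ∈edgesAt⁺ : ∀ {i v} → v ∈ E i → i ∈ edgesAt E v
  ∈edgesAt⁺ v∈ = ∈-tabulate⁺ ([]=⇒lookup v∈)

  ∈edgesAt⁻ : ∀ {i v} → i ∈ edgesAt E v → v ∈ E i
  ∈edgesAt⁻ {i} {v} i∈ = lookup⇒[]= v (E i) (∈-tabulate⁻ i∈)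

  ∈core⁻ : ∀ {i v} → v ∈ core E i → v ∈ E i × degree E v ≢ 1
  ∈core⁻ v∈ = let v∈Ei , ok = ∈-restrict⁻ v∈ in v∈Ei , ≢ᵇ⁻ ok

  ∈core⁺ : ∀ {i v} → v ∈ E i → degree E v ≢ 1 → v ∈ core E i
  ∈core⁺ {v = v} v∈ deg≢1 = ∈-restrict⁺ v∈ (cong not (dec-false (degree E v ≟ 1) deg≢1))

  ∈isolated⁻ : ∀ {i v} → v ∈ isolatedIn E i → v ∈ E i × degree E v ≡ 1
  ∈isolated⁻ v∈ = let v∈Ei , ok = ∈-restrict⁻ v∈ in v∈Ei , ≡ᵇ⁻ ok

  ∈isolated⁺ : ∀ {i v} → v ∈ E i → degree E v ≡ 1 → v ∈ isolatedIn E i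
  ∈isolated⁺ {v = v} v∈ deg≡1 = ∈-restrict⁺ v∈ (dec-true (degree E v ≟ 1) deg≡1)

  isolated+core : ∀ i → ∣ isolatedIn E i ∣ + ∣ core E i ∣ ≡ ∣ E i ∣
  isolated+core i = split-count (E i) (λ v → degree E v ≡ᵇ 1)

  elsewhere⇒not-isolated : ∀ {i j v} → v ∈ E j → j ≢ i → v ∉ isolatedIn E i
  elsewhere⇒not-isolated v∈Ej j≢i v∈iso with v∈Ei , deg≡1 ← ∈isolated⁻ v∈iso =
    contradiction (subst (2 ≤_) deg≡1 (two-members (∈edgesAt⁺ v∈Ej) (∈edgesAt⁺ v∈Ei) j≢i))
                  λ { (s≤s ()) }

-- In a connected hypergraph, a vertex is covered by a hyperedge as soon
-- as some hyperedge is nonempty: the first step of a walk to it supplies one.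
covered : ∀ {n s} {V : Subset n} {E : Fin s → Subset n} → Connected V E →
          ∀ {i u} → u ∈ E i → E i ⊆ V → ∀ {v} → v ∈ V → 1 ≤ degree E v
covered {E = E} C {i} {u} u∈Ei Ei⊆V {v} v∈V with C v u v∈V (Ei⊆V u∈Ei)
... | ε                  = one-member (∈edgesAt⁺ {E = E} u∈Ei)
... | (j , v∈Ej , _) ◅ _ = one-member (∈edgesAt⁺ {E = E} v∈Ej)

-- Contribution of a vertex of degree k (lying in V iff b) to the
-- double count: its core degree plus twice its V-indicator is at most 2k.
vertex-weight : ∀ k b → (b ≡ true → 1 ≤ k) → 𝟙 (not (k ≡ᵇ 1)) * k + (𝟙 b + 𝟙 b) ≤ k + k
vertex-weight zero          false _  = z≤n
vertex-weight zero          true  k≥1 with () ← k≥1 refl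
vertex-weight (suc zero)    false _  = z≤n
vertex-weight (suc zero)    true  _  = ≤-refl
vertex-weight (suc (suc j)) b     _  = +-mono-≤ (≤-reflexive (*-identityˡ (suc (suc j)))) (twice≤ b)
  where
  twice≤ : ∀ b → 𝟙 b + 𝟙 b ≤ suc (suc j)
  twice≤ true  = s≤s (s≤s z≤n)
  twice≤ false = z≤n

tight-weight : ∀ k → k ≢ 1 → 𝟙 (not (k ≡ᵇ 1)) * k + 2 ≡ k + k → k ≡ 2
tight-weight zero          _   ()
tight-weight (suc zero)    k≢1 _  = contradiction refl k≢1
tight-weight (suc (suc j)) _   eq =
  sym (+-cancelˡ-≡ (suc (suc j)) 2 _ (trans (cong (_+ 2) (sym (*-identityˡ (suc (suc j))))) eq))

-- The identity 2sd = 2s + 2s(d-1) splitting the right side of (★).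
double-sd : ∀ s {d} → 2 ≤ d → s * d + s * d ≡ s * 2 + (s * (d ∸ 1) + s * (d ∸ 1))
double-sd s {suc (suc k)} (s≤s (s≤s z≤n)) = identity s k
  where
  identity : ∀ s k → s * suc (suc k) + s * suc (suc k) ≡ s * 2 + (s * suc k + s * suc k)
  identity = solve-∀

two-core : ∀ {d i c} → 2 ≤ d → i + c ≡ d → ¬ (d ∸ 1 ≤ i) → 2 ≤ c
two-core {suc (suc k)} {i} {c} (s≤s (s≤s z≤n)) i+c≡d i≱ with 2 ≤? c
... | yes 2≤c = 2≤c
... | no  2≰c = contradiction (begin
      suc (suc k)  ≡⟨ i+c≡d ⟨
      i + c        ≤⟨ +-mono-≤ (≤-pred (≰⇒> i≱)) (≤-pred (≰⇒> 2≰c)) ⟩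
      k + 1        ≡⟨ +-comm k 1 ⟩
      suc k        ∎) 1+n≰n
  where open ≤-Reasoning

-- The arithmetic of the hypertree case: 2s core vertices and 2s(d-1)+2
-- vertex incidences do not fit into 2sd.
overfull : ∀ {a x q} → a ≤ x → ¬ (x + ((q + 1) + (q + 1)) ≤ a + (q + q))
overfull {a} {x} {q} a≤x too-many = 1+n≰n (begin
  suc (x + (q + q))            ≤⟨ n≤1+n _ ⟩
  suc (suc (x + (q + q)))      ≡⟨ identity x q ⟩
  x + ((q + 1) + (q + 1))      ≤⟨ too-many ⟩
  a + (q + q)                  ≤⟨ +-monoˡ-≤ (q + q) a≤x ⟩
  x + (q + q)                  ∎)
  where
  open ≤-Reasoning
  identity : ∀ x q → suc (suc (x + (q + q))) ≡ x + ((q + 1) + (q + 1))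
  identity = solve-∀

-- Vertex count after deleting a hyperedge with d-2 isolated vertices:
-- x + (d-2) = (s′+1)(d-1) gives x = s′(d-1) + 1.
removed-size : ∀ {d s′ x} → 2 ≤ d → x + (d ∸ 2) ≡ suc s′ * (d ∸ 1) → x ≡ s′ * (d ∸ 1) + 1
removed-size {suc (suc k)} {s′} {x} (s≤s (s≤s z≤n)) eq = +-cancelʳ-≡ k x _ (trans eq (identity s′ k))
  where
  identity : ∀ s′ k → suc s′ * suc k ≡ (s′ * suc k + 1) + k
  identity = solve-∀

-- Double counting in a d-uniform hypergraph whose vertices are all covered:
--   Σᵢ ∣core i∣ + 2∣V∣ ≤ 2sd,
-- with equality only if every core vertex has degree exactly 2.
module CoreCount {n s} (d : ℕ) (V : Subset n) (E : Fin s → Subset n)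
  (U : IsUniformHypergraph d V E) (covers : ∀ {v} → v ∈ V → 1 ≤ degree E v) where

  deg : Fin n → ℕ
  deg = degree E

  core-size : Fin s → ℕ
  core-size i = ∣ core E i ∣

  core-degree : Fin n → ℕ
  core-degree v = ∣ tabulate (λ i → lookup (E i) v ∧ not (deg v ≡ᵇ 1)) ∣

  -- a vertex lies in the cores of all its hyperedges, or of none if isolated
  core-degree≡ : ∀ v → core-degree v ≡ 𝟙 (not (deg v ≡ᵇ 1)) * deg v
  core-degree≡ v = count-∧-const (λ i → lookup (E i) v) (not (deg v ≡ᵇ 1))

  in-V : Fin n → ℕ
  in-V v = 𝟙 (lookup V v)

  -- the left side of (★), vertex by vertex
  weight : Fin n → ℕ
  weight v = core-degree v + (in-V v + in-V v)

  weight≤ : ∀ v → weight v ≤ deg v + deg v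
  weight≤ v = begin
    weight v                                          ≡⟨ cong (_+ (in-V v + in-V v)) (core-degree≡ v) ⟩
    𝟙 (not (deg v ≡ᵇ 1)) * deg v + (in-V v + in-V v)  ≤⟨ vertex-weight (deg v) (lookup V v) (covers ∘ lookup⇒[]= v V) ⟩
    deg v + deg v                                     ∎
    where open ≤-Reasoning

  degree-sum : sum deg ≡ s * d
  degree-sum = begin
    sum deg                                  ≡⟨ double-count (λ i v → lookup (E i) v) ⟨
    sum (λ i → ∣ tabulate (lookup (E i)) ∣)  ≡⟨ sum-cong-≗ uniform ⟩
    sum {s} (λ _ → d)                        ≡⟨ sum-const s d ⟩
    s * d                                    ∎
    where
    open ≡-Reasoning
    uniform : ∀ i → ∣ tabulate (lookup (E i)) ∣ ≡ d
    uniform i = trans (cong ∣_∣ (tabulate∘lookup (E i))) (proj₁ (proj₁ U i))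

  weight-sum : sum weight ≡ sum core-size + (∣ V ∣ + ∣ V ∣)
  weight-sum = begin
    sum weight
      ≡⟨ ∑-distrib-+ core-degree (λ v → in-V v + in-V v) ⟩
    sum core-degree + sum (λ v → in-V v + in-V v)
      ≡⟨ cong₂ _+_ (sym (double-count (λ i v → lookup (E i) v ∧ not (deg v ≡ᵇ 1))))
                   (∑-distrib-+ in-V in-V) ⟩
    sum core-size + (sum in-V + sum in-V)
      ≡⟨ cong (λ r → sum core-size + (r + r)) (∣∣≡sum V) ⟨
    sum core-size + (∣ V ∣ + ∣ V ∣) ∎
    where open ≡-Reasoning

  double-degree-sum : sum (λ v → deg v + deg v) ≡ s * d + s * d
  double-degree-sum = trans (∑-distrib-+ deg deg) (cong₂ _+_ degree-sum degree-sum)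

  core-bound : sum core-size + (∣ V ∣ + ∣ V ∣) ≤ s * d + s * d
  core-bound = subst₂ _≤_ weight-sum double-degree-sum (sum-mono weight≤)

  core-tight : sum core-size + (∣ V ∣ + ∣ V ∣) ≡ s * d + s * d →
               ∀ {i v} → v ∈ core E i → deg v ≡ 2
  core-tight total {i} {v} v∈core = tight-weight (deg v) deg≢1 (begin
    𝟙 (not (deg v ≡ᵇ 1)) * deg v + 2  ≡⟨ cong₂ (λ c b → c + (𝟙 b + 𝟙 b)) (core-degree≡ v) v∈V ⟨
    weight v                          ≡⟨ sum-tight weight≤ no-slack v ⟩
    deg v + deg v                     ∎)
    where
    open ≡-Reasoning
    no-slack : sum (λ v → deg v + deg v) ≤ sum weight
    no-slack = ≤-reflexive (trans double-degree-sum (trans (sym total) (sym weight-sum)))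
    v∈Ei : v ∈ E i
    v∈Ei = proj₁ (∈core⁻ {E = E} v∈core)
    deg≢1 : deg v ≢ 1
    deg≢1 = proj₂ (∈core⁻ {E = E} v∈core)
    v∈V : lookup V v ≡ true
    v∈V = []=⇒lookup (proj₂ (proj₁ U i) v∈Ei)

module LeafAnalysis {n s} (d : ℕ) (V : Subset n) (E : Fin s → Subset n) (2≤d : 2 ≤ d)
  (U : IsUniformHypergraph d V E) (covers : ∀ {v} → v ∈ V → 1 ≤ degree E v) where

  open CoreCount d V E U covers

  Leaf : Set
  Leaf = ∃ λ i → d ∸ 1 ≤ ∣ isolatedIn E i ∣

  leaf? : Dec Leaf
  leaf? = any? λ i → d ∸ 1 ≤? ∣ isolatedIn E i ∣

  isolated+core≡d : ∀ i → ∣ isolatedIn E i ∣ + core-size i ≡ d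
  isolated+core≡d i = trans (isolated+core {E = E} i) (proj₁ (proj₁ U i))

  no-leaf⇒two-core : ¬ Leaf → ∀ i → 2 ≤ core-size i
  no-leaf⇒two-core ¬leaf i = two-core 2≤d (isolated+core≡d i) (¬leaf ∘ (i ,_))

  two-core-sum : ¬ Leaf → s * 2 ≤ sum core-size
  two-core-sum ¬leaf = subst (_≤ sum core-size) (sum-const s 2) (sum-mono (no-leaf⇒two-core ¬leaf))

  hypertree-leaf : ∣ V ∣ ≡ s * (d ∸ 1) + 1 → Leaf
  hypertree-leaf r≡ with leaf?
  ... | yes leaf = leaf
  ... | no ¬leaf = ⊥-elim (overfull {q = s * (d ∸ 1)} (two-core-sum ¬leaf)
        (subst₂ (λ r t → sum core-size + (r + r) ≤ t) r≡ (double-sd s 2≤d) core-bound))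

  record Tight : Set where
    field
      core-size≡2   : ∀ i → ∣ core E i ∣ ≡ 2
      core-degree≡2 : ∀ {i v} → v ∈ core E i → degree E v ≡ 2
      isolated≡d∸2  : ∀ i → ∣ isolatedIn E i ∣ ≡ d ∸ 2

  unicyclic-tight : ∣ V ∣ ≡ s * (d ∸ 1) → ¬ Leaf → Tight
  unicyclic-tight r≡ ¬leaf = record
    { core-size≡2   = core-pair
    ; core-degree≡2 = core-tight total
    ; isolated≡d∸2  = isolated-count
    }
    where
    q : ℕ
    q = s * (d ∸ 1)
    core-bound′ : sum core-size + (q + q) ≤ s * 2 + (q + q)
    core-bound′ = subst₂ (λ r t → sum core-size + (r + r) ≤ t) r≡ (double-sd s 2≤d) core-bound
    core-pair : ∀ i → core-size i ≡ 2
    core-pair i = sym (sum-tight (no-leaf⇒two-core ¬leaf)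
      (subst (sum core-size ≤_) (sym (sum-const s 2)) (+-cancelʳ-≤ (q + q) _ _ core-bound′)) i)
    isolated-count : ∀ i → ∣ isolatedIn E i ∣ ≡ d ∸ 2
    isolated-count i = begin
      ∣ isolatedIn E i ∣                    ≡⟨ m+n∸n≡m ∣ isolatedIn E i ∣ 2 ⟨
      ∣ isolatedIn E i ∣ + 2 ∸ 2            ≡⟨ cong (λ c → ∣ isolatedIn E i ∣ + c ∸ 2) (core-pair i) ⟨
      ∣ isolatedIn E i ∣ + core-size i ∸ 2  ≡⟨ cong (_∸ 2) (isolated+core≡d i) ⟩
      d ∸ 2                                 ∎
      where open ≡-Reasoning
    total : sum core-size + (∣ V ∣ + ∣ V ∣) ≡ s * d + s * d
    total = begin
      sum core-size + (∣ V ∣ + ∣ V ∣)      ≡⟨ cong (λ c → c + (∣ V ∣ + ∣ V ∣)) (sum-cong-≗ core-pair) ⟩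
      sum {s} (λ _ → 2) + (∣ V ∣ + ∣ V ∣)  ≡⟨ cong₂ (λ c r → c + (r + r)) (sum-const s 2) r≡ ⟩
      s * 2 + (q + q)                      ≡⟨ double-sd s 2≤d ⟨
      s * d + s * d                        ∎
      where open ≡-Reasoning

-- Deleting hyperedge o together with its isolated vertices preserves
-- d-uniformity: the remaining hyperedges avoid the deleted vertices.
remove-uniform : ∀ {n s′ d} {V : Subset n} {E : Fin (suc s′) → Subset n} →
                 IsUniformHypergraph d V E → (o : Fin (suc s′)) →
                 IsUniformHypergraph d (V ─ isolatedIn E o) (E ∘ punchIn o)
remove-uniform {E = E} U o =
  (λ j → proj₁ (proj₁ U (punchIn o j)) ,
         λ x∈ → x∈p∧x∉q⇒x∈p─q (proj₂ (proj₁ U (punchIn o j)) x∈)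
                              (elsewhere⇒not-isolated {E = E} x∈ (punchInᵢ≢i o j))) ,
  punchIn-injective o _ _ ∘ proj₂ U

-- In a connected hypergraph in which every hyperedge has exactly two core
-- vertices, each of degree 2, the core forms a single cycle, so deleting a
-- hyperedge o (and its isolated vertices) leaves the hypergraph connected.
-- The two core vertices a, b of o are joined avoiding o by following the
-- cycle: a flag (e , v) is a core vertex v of e, and the rotation steps to
-- the other hyperedge at v and then to its other core vertex.
module RemoveEdge {n s′} (V : Subset n) (E : Fin (suc s′) → Subset n) (C : Connected V E)
  (core-size≡2 : ∀ i → ∣ core E i ∣ ≡ 2)
  (core-degree≡2 : ∀ {i v} → v ∈ core E i → degree E v ≡ 2)
  (o : Fin (suc s′)) where

  E′ : Fin s′ → Subset n
  E′ = E ∘ punchIn o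

  _⇝_ : Fin n → Fin n → Set
  _⇝_ = Star (Adjacent E′)

  Flag : Set
  Flag = Fin (suc s′) × Fin n

  IsFlag : Flag → Set
  IsFlag (e , v) = v ∈ core E e

  switch-edge : Flag → Flag
  switch-edge (e , v) = partner (edgesAt E v) e , v

  switch-vertex : Flag → Flag
  switch-vertex (e , v) = e , partner (core E e) v

  module EdgesAt {e v} (flag : IsFlag (e , v)) = Pair {p = edgesAt E v} (core-degree≡2 flag)
  module Core (e : Fin (suc s′)) = Pair {p = core E e} (core-size≡2 e)

  edge∈edgesAt : ∀ {e v} → IsFlag (e , v) → e ∈ edgesAt E v
  edge∈edgesAt flag = ∈edgesAt⁺ {E = E} (proj₁ (∈core⁻ {E = E} flag))

  switch-edge-closed : ∀ {x} → IsFlag x → IsFlag (switch-edge x)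
  switch-edge-closed flag =
    ∈core⁺ {E = E} (∈edgesAt⁻ {E = E} (EdgesAt.partner-∈ flag (edge∈edgesAt flag)))
                   (proj₂ (∈core⁻ {E = E} flag))

  switch-vertex-closed : ∀ {x} → IsFlag x → IsFlag (switch-vertex x)
  switch-vertex-closed {e , _} = Core.partner-∈ e

  switch-edge-involutive : ∀ {x} → IsFlag x → switch-edge (switch-edge x) ≡ x
  switch-edge-involutive {_ , v} flag =
    cong (_, v) (EdgesAt.partner-involutive flag (edge∈edgesAt flag))

  switch-vertex-involutive : ∀ {x} → IsFlag x → switch-vertex (switch-vertex x) ≡ x
  switch-vertex-involutive {e , _} flag = cong (e ,_) (Core.partner-involutive e flag)

  switch-edge-moves : ∀ {x} → IsFlag x → switch-edge x ≢ x
  switch-edge-moves flag = EdgesAt.partner-≢ flag (edge∈edgesAt flag) ∘ cong proj₁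

  switch-vertex-moves : ∀ {x} → IsFlag x → switch-vertex x ≢ x
  switch-vertex-moves {e , _} flag = Core.partner-≢ e flag ∘ cong proj₂

  open Reflections IsFlag switch-edge switch-vertex switch-edge-closed switch-vertex-closed
    switch-edge-involutive switch-vertex-involutive switch-edge-moves switch-vertex-moves

  code : Flag → Fin (suc s′ * n)
  code (e , v) = combine e v

  code-injective : ∀ {x y} → code x ≡ code y → x ≡ y
  code-injective {e , v} {e′ , v′} eq with refl , refl ← combine-injective e v e′ v′ eq = refl

  core-o : Nonempty (core E o)
  core-o = nonempty (subst (1 ≤_) (sym (core-size≡2 o)) (s≤s z≤n))

  a : Fin n
  a = proj₁ core-o

  b : Fin n
  b = partner (core E o) a

  x₀ : Flag
  x₀ = o , proj₁ core-o

  x₀-flag : IsFlag x₀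
  x₀-flag = proj₂ core-o

  -- A flag whose rotation enters o sits at b, unless it is switch-edge x₀
  -- (the flag at a whose other hyperedge is o).
  entering-o : ∀ {y} → IsFlag y → proj₁ (rotate y) ≡ o → y ≢ switch-edge x₀ → proj₂ y ≡ b
  entering-o {e , v} flag e′≡o y≢
    with Core.partner-cases o x₀-flag (subst (λ e′ → v ∈ core E e′) e′≡o (switch-edge-closed flag))
  ... | inj₂ v≡b = v≡b
  ... | inj₁ v≡a = contradiction (begin
        (e , v)                            ≡⟨ switch-edge-involutive flag ⟨
        switch-edge (switch-edge (e , v))  ≡⟨ cong switch-edge (cong₂ _,_ e′≡o v≡a) ⟩
        switch-edge x₀                     ∎) y≢
    where open ≡-Reasoning

  survives : ∀ {e x y} → e ≢ o → x ∈ E e → y ∈ E e → Adjacent E′ x y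
  survives {e} {x} {y} e≢o x∈ y∈ =
    punchOut o≢e , subst (λ i → x ∈ E i) (sym (punchIn-punchOut o≢e)) x∈
                 , subst (λ i → y ∈ E i) (sym (punchIn-punchOut o≢e)) y∈
    where
    o≢e : o ≢ e
    o≢e = e≢o ∘ sym

  rotate-step : ∀ {y} → IsFlag y →
                proj₂ y ∈ E (proj₁ (rotate y)) × proj₂ (rotate y) ∈ E (proj₁ (rotate y))
  rotate-step flag = proj₁ (∈core⁻ {E = E} (switch-edge-closed flag))
                   , proj₁ (∈core⁻ {E = E} (switch-vertex-closed (switch-edge-closed flag)))

  walk-or-arrived : ∀ k → a ⇝ b ⊎ a ⇝ proj₂ (rotate^ k x₀)
  walk-or-arrived zero = inj₂ ε
  walk-or-arrived (suc k) = extend (walk-or-arrived k) (proj₁ (rotate^ (suc k) x₀) ≟ᶠ o)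
    where
    step : proj₂ (rotate^ k x₀) ∈ E (proj₁ (rotate^ (suc k) x₀))
         × proj₂ (rotate^ (suc k) x₀) ∈ E (proj₁ (rotate^ (suc k) x₀))
    step = rotate-step (rotate^-closed k x₀-flag)
    extend : a ⇝ b ⊎ a ⇝ proj₂ (rotate^ k x₀) → Dec (proj₁ (rotate^ (suc k) x₀) ≡ o) →
             a ⇝ b ⊎ a ⇝ proj₂ (rotate^ (suc k) x₀)
    extend (inj₁ a⇝b) _         = inj₁ a⇝b
    extend (inj₂ a⇝v) (yes e≡o) =
      inj₁ (subst (a ⇝_) (entering-o (rotate^-closed k x₀-flag) e≡o (never-reflects k x₀-flag)) a⇝v)
    extend (inj₂ a⇝v) (no  e≢o) = inj₂ (a⇝v ◅◅ survives e≢o (proj₁ step) (proj₂ step) ◅ ε)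

  -- The orbit returns to x₀, hence enters o; so a and b are joined avoiding o.
  a⇝b : a ⇝ b
  a⇝b = closes (returns code code-injective x₀-flag)
    where
    closes : (∃ λ t → rotate^ (suc t) x₀ ≡ x₀) → a ⇝ b
    closes (t , back) = [ id , subst (a ⇝_) arrives-at-b ]′ (walk-or-arrived t)
      where
      arrives-at-b : proj₂ (rotate^ t x₀) ≡ b
      arrives-at-b = entering-o (rotate^-closed t x₀-flag) (cong proj₁ back) (never-reflects t x₀-flag)

  -- collapse the vertices of o onto its core vertices: isolated ones go to a
  retract : Fin n → Fin n
  retract v with v ∈? isolatedIn E o
  ... | yes _ = a
  ... | no  _ = v

  retract-fixes : ∀ {v} → v ∉ isolatedIn E o → retract v ≡ v
  retract-fixes {v} v∉ with v ∈? isolatedIn E o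
  ... | yes v∈ = contradiction v∈ v∉
  ... | no  _  = refl

  retract-o : ∀ {v} → v ∈ E o → retract v ≡ a ⊎ retract v ≡ b
  retract-o {v} v∈ with v ∈? isolatedIn E o
  ... | yes _  = inj₁ refl
  ... | no  v∉ = Core.partner-cases o x₀-flag (∈core⁺ {E = E} v∈ (v∉ ∘ ∈isolated⁺ {E = E} v∈))

  between-a-b : ∀ {x y} → x ≡ a ⊎ x ≡ b → y ≡ a ⊎ y ≡ b → x ⇝ y
  between-a-b (inj₁ refl) (inj₁ refl) = ε
  between-a-b (inj₁ refl) (inj₂ refl) = a⇝b
  between-a-b (inj₂ refl) (inj₁ refl) = reverse (λ (j , x∈ , y∈) → j , y∈ , x∈) a⇝b
  between-a-b (inj₂ refl) (inj₂ refl) = ε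

  retract-step : ∀ {x y} → Adjacent E x y → retract x ⇝ retract y
  retract-step {x} {y} (e , x∈ , y∈) with e ≟ᶠ o
  ... | yes refl = between-a-b (retract-o x∈) (retract-o y∈)
  ... | no  e≢o  = subst₂ _⇝_ (sym (retract-fixes (elsewhere⇒not-isolated {E = E} x∈ e≢o)))
                              (sym (retract-fixes (elsewhere⇒not-isolated {E = E} y∈ e≢o)))
                              (survives e≢o x∈ y∈ ◅ ε)

  connected′ : Connected (V ─ isolatedIn E o) E′
  connected′ u v u∈ v∈ =
    subst₂ _⇝_ (retract-fixes (∈─⇒∉ V _ u∈)) (retract-fixes (∈─⇒∉ V _ v∈))
      (kleisliStar retract retract-step (C u v (p─q⊆p V _ u∈) (p─q⊆p V _ v∈)))

lemma3p6 : ∀ {n s′} (d : ℕ) (V : Subset n) (E : Fin (suc s′) → Subset n) →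
  2 ≤ d →
  IsUniformHypergraph d V E →
  Connected V E →
  (IsHypertree d V E → ∃ λ i → d ∸ 1 ≤ ∣ isolatedIn E i ∣)
  ×
  (IsUnicyclic d V E →
    (∃ λ i → d ∸ 1 ≤ ∣ isolatedIn E i ∣)
    ⊎
    (∃ λ i → ∣ isolatedIn E i ∣ ≡ d ∸ 2
           × IsHypertree d (V ─ isolatedIn E i) (λ j → E (punchIn i j))))
lemma3p6 {n} {s′} d V E 2≤d U C = hypertree-leaf ∘ proj₂ ∘ proj₂ , unicyclic-case
  where
  vertex₀ : Nonempty (E zero)
  vertex₀ = nonempty (subst (1 ≤_) (sym (proj₁ (proj₁ U zero))) (≤-trans (s≤s z≤n) 2≤d))

  open LeafAnalysis d V E 2≤d U (covered C (proj₂ vertex₀) (proj₂ (proj₁ U zero)))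

  Prunable : Fin (suc s′) → Set
  Prunable i = ∣ isolatedIn E i ∣ ≡ d ∸ 2 × IsHypertree d (V ─ isolatedIn E i) (E ∘ punchIn i)

  prune : ∣ V ∣ ≡ suc s′ * (d ∸ 1) → Tight → Prunable zero
  prune r≡ tight = isolated≡d∸2 zero , remove-uniform U zero
                 , RemoveEdge.connected′ V E C core-size≡2 core-degree≡2 zero
                 , removed-size {d} {s′} 2≤d count
    where
    open Tight tight
    open ≡-Reasoning
    I₀ : Subset n
    I₀ = isolatedIn E zero
    count : ∣ V ─ I₀ ∣ + (d ∸ 2) ≡ suc s′ * (d ∸ 1)
    count = begin
      ∣ V ─ I₀ ∣ + (d ∸ 2)   ≡⟨ cong (∣ V ─ I₀ ∣ +_) (isolated≡d∸2 zero) ⟨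
      ∣ V ─ I₀ ∣ + ∣ I₀ ∣    ≡⟨ ∣p─q∣+∣q∣ V I₀ (proj₂ (proj₁ U zero) ∘ proj₁ ∘ ∈isolated⁻ {E = E}) ⟩
      ∣ V ∣                  ≡⟨ r≡ ⟩
      suc s′ * (d ∸ 1)       ∎

  unicyclic-case : IsUnicyclic d V E → Leaf ⊎ ∃ Prunable
  unicyclic-case (_ , _ , r≡) with leaf?
  ... | yes leaf = inj₁ leaf
  ... | no ¬leaf = inj₂ (zero , prune r≡ (unicyclic-tight r≡ ¬leaf))
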